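{- Let $G=(V,E)$ be a twin-free graph of maximum degree $k$ and let $C$ be an identifying code of $G$ with $k\ge |C|+1$. Then $$|V|\le \frac{|C|^2}{6}+\frac{(2k+5)|C|}{6}.$$
   Context: All graphs are finite, simple and undirected. $N[u]$ denotes the closed neighbourhood of $u$ ($u$ and its neighbours). A graph is twin-free if there are no two distinct vertices $u,v$ with $N[u]=N[v]$. An identifying code is a set $C\subseteq V$ such that $N[u]\cap C\neq\emptyset$ for every $u\in V$ and $N[u]\cap C\neq N[v]\cap C$ for all distinct $u,v\in V$. -}

module Defs where

open import Data.Nat using (ℕ; _≤_)
open import Data.Bool using (Bool; true; false; _∧_; _∨_)
open import Data.Fin using (Fin; _≟_)
open import Data.Fin.Subset using (Subset; _∩_; ∣_∣; _∈_; Nonempty)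
open import Data.Vec using (tabulate)
open import Data.Product using (∃; _×_)
open import Relation.Binary.PropositionalEquality using (_≡_)
open import Relation.Nullary using (¬_; yes; no)

record Graph (n : ℕ) : Set where
  field
    adj   : Fin n → Fin n → Bool
    sym   : ∀ u v → adj u v ≡ adj v u
    irref : ∀ u → adj u u ≡ false

open Graph public

N : ∀ {n} → Graph n → Fin n → Subset n
N G u = tabulate (λ v → adj G u v)

decEq? : ∀ {n} → Fin n → Fin n → Bool
decEq? u v with u ≟ v
... | yes _ = true
... | no _ = false

N[_,_] : ∀ {n} → Graph n → Fin n → Subset n
N[ G , u ] = tabulate (λ v → decEq? u v ∨ adj G u v)

degree : ∀ {n} → Graph n → Fin n → ℕ
degree G u = ∣ N G u ∣

MaxDegree : ∀ {n} → Graph n → ℕ → Set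
MaxDegree G k = (∀ u → degree G u ≤ k) × ∃ (λ u → degree G u ≡ k)

TwinFree : ∀ {n} → Graph n → Set
TwinFree G = ∀ u v → N[ G , u ] ≡ N[ G , v ] → u ≡ v

IdentifyingCode : ∀ {n} → Graph n → Subset n → Set
IdentifyingCode G C =
  (∀ u → Nonempty (N[ G , u ] ∩ C)) ×
  (∀ u v → ¬ (u ≡ v) → ¬ (N[ G , u ] ∩ C ≡ N[ G , v ] ∩ C))

module Submission where

-- Put s(v) = |N[v] ∩ C| ≥ 1. Since C is identifying, v ↦ N[v] ∩ C is injective, so at most
-- |C| vertices have s(v) = 1 and at most |C|(|C| - 1)/2 have s(v) = 2; double counting the
-- incidences between V and C gives Σ s(v) ≤ (k + 1)|C|. Summing 6 ≤ 2 s + 4 [s = 1] + 2 [s = 2]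
-- over all vertices yields 6|V| ≤ 2(k + 1)|C| + 4|C| + |C|(|C| - 1).

open import Defs hiding (sym)
open import Function.Definitions using (Injective)
open import Data.Bool using (Bool; true; false; _∧_; _∨_; not; T)
open import Data.Bool.Properties using (T-∧; T-≡; ∧-idem)
open import Data.Fin using (Fin; zero; suc; _≟_; punchIn)
open import Data.Fin.Properties using (0≢1+n; punchInᵢ≢i; suc-injective)
open import Data.Fin.Subset using (Subset; Nonempty; ∣_∣; _∈_; _⊆_; _∩_; _∪_; ⁅_⁆; inside; outside)
open import Data.Fin.Subset.Properties
  using ( drop-∷-⊆; p∩q⊆q; p⊆q⇒∣p∣≤∣q∣; p⊂q⇒∣p∣<∣q∣; x∈⁅x⁆; x∈⁅y⁆⇒x≡y; x≢y⇒x∉⁅y⁆; ∣⁅x⁆∣≡1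
        ; p⊆p∪q; x∈p∪q⁺; x∈p∪q⁻)
open import Data.Nat using (ℕ; zero; suc; _+_; _*_; _≤_; _<_; z≤n; s≤s; _≡ᵇ_)
open import Data.Nat.Solver using (module +-*-Solver)
open import Data.Nat.Properties
  using ( ≤-refl; ≤-trans; ≤-reflexive; m≤m+n; n≮n; module ≤-Reasoning; *-comm; *-monoʳ-≤
        ; +-mono-≤; +-identityʳ; +-cancelʳ-≡; ≡ᵇ⇒≡; +-*-semiring)
open import Data.Product using (_×_; _,_; proj₂)
open import Data.Sum using (inj₂; [_,_])
open import Data.Vec using ([]; _∷_; lookup; here)
open import Data.Vec.Properties using ([]=⇒lookup; lookup⇒[]=; lookup∘tabulate; lookup-zipWith)
open import Function using (_∘_; Equivalence; mk⇔)
open import Relation.Binary.PropositionalEquality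
  using (_≡_; _≢_; refl; sym; trans; cong; cong₂; subst; module ≡-Reasoning)
open import Relation.Nullary using (¬_; yes; no; does; contradiction)
open import Relation.Nullary.Decidable using (dec-true; dec-false; does-⇔)
open import Algebra.Properties.Semiring.Sum +-*-semiring
  using ( sum; sum-syntax; sum-cong-≗; sum-replicate-zero; sum-remove; ∑-comm; ∑-distrib-+
        ; *-distribˡ-sum; *-distribʳ-sum)

𝟙 : Bool → ℕ
𝟙 true  = 1
𝟙 false = 0

𝟙-∧ : ∀ a b → 𝟙 (a ∧ b) ≡ 𝟙 a * 𝟙 b
𝟙-∧ true  b = sym (+-identityʳ (𝟙 b))
𝟙-∧ false b = refl

𝟙-∨ : ∀ a b → 𝟙 (a ∨ b) ≤ 𝟙 a + 𝟙 b
𝟙-∨ true  b = s≤s z≤n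
𝟙-∨ false b = ≤-refl

𝟙-split : ∀ d b → 𝟙 b ≡ 𝟙 (not d ∧ b) + 𝟙 (d ∧ b)
𝟙-split true  b = refl
𝟙-split false b = sym (+-identityʳ (𝟙 b))

T-∧⁻ : ∀ {a b} → T (a ∧ b) → T a × T b
T-∧⁻ = Equivalence.to T-∧

T-∧⁺ : ∀ {a b} → T a → T b → T (a ∧ b)
T-∧⁺ ta tb = Equivalence.from T-∧ (ta , tb)

¬T⇒𝟙≡0 : ∀ {b} → ¬ T b → 𝟙 b ≡ 0
¬T⇒𝟙≡0 {true}  ¬b = contradiction _ ¬b
¬T⇒𝟙≡0 {false} _  = refl

∑-mono-≤ : ∀ {n} {f g : Fin n → ℕ} → (∀ i → f i ≤ g i) → sum f ≤ sum g
∑-mono-≤ {zero}  _   = z≤n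
∑-mono-≤ {suc n} f≤g = +-mono-≤ (f≤g zero) (∑-mono-≤ (f≤g ∘ suc))

∑-const : ∀ n a → ∑[ i < n ] a ≡ n * a
∑-const zero    a = refl
∑-const (suc n) a = cong (a +_) (∑-const n a)

∑-zero : ∀ {n} (f : Fin n → ℕ) → (∀ i → f i ≡ 0) → sum f ≡ 0
∑-zero {n} f f≡0 = trans (sum-cong-≗ f≡0) (sum-replicate-zero n)

∑-concentrated : ∀ {n} (f : Fin n → ℕ) x → (∀ y → y ≢ x → f y ≡ 0) → sum f ≡ f x
∑-concentrated {suc n} f x f≡0 = begin
  sum f                      ≡⟨ sum-remove f ⟩
  f x + sum (f ∘ punchIn x)  ≡⟨ cong (f x +_) (∑-zero _ (λ j → f≡0 _ (punchInᵢ≢i x j))) ⟩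
  f x + 0                    ≡⟨ +-identityʳ (f x) ⟩
  f x                        ∎
  where open ≡-Reasoning

∑-𝟙-atMostOne : ∀ {n} (P : Fin n → Bool) → (∀ {v w} → T (P v) → T (P w) → v ≡ w) →
                ∑[ v < n ] 𝟙 (P v) ≤ 1
∑-𝟙-atMostOne {zero}  P unique = z≤n
∑-𝟙-atMostOne {suc n} P unique with P zero in P₀
... | true  = s≤s (≤-reflexive (∑-zero (𝟙 ∘ P ∘ suc) (λ i → ¬T⇒𝟙≡0 (0≢1+n ∘ unique P₀true))))
  where
    P₀true : T (P zero)
    P₀true = subst T (sym P₀) _
... | false = ∑-𝟙-atMostOne (P ∘ suc) (λ Pv Pw → suc-injective (unique Pv Pw))

∑-𝟙-unique≤𝟙 : ∀ {n} (P : Fin n → Bool) (b : Bool) →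
               (∀ {v w} → T (P v) → T (P w) → v ≡ w) → (∀ {v} → T (P v) → T b) →
               ∑[ v < n ] 𝟙 (P v) ≤ 𝟙 b
∑-𝟙-unique≤𝟙 P true  unique _   = ∑-𝟙-atMostOne P unique
∑-𝟙-unique≤𝟙 P false _      P⇒b = ≤-reflexive (∑-zero (𝟙 ∘ P) (λ v → ¬T⇒𝟙≡0 P⇒b))

decEq?≡does : ∀ {n} (u v : Fin n) → decEq? u v ≡ does (u ≟ v)
decEq?≡does u v with u ≟ v
... | yes _ = refl
... | no  _ = refl

decEq?-refl : ∀ {n} (u : Fin n) → decEq? u u ≡ true
decEq?-refl u = trans (decEq?≡does u u) (dec-true (u ≟ u) refl)

decEq?-≢ : ∀ {n} {u v : Fin n} → u ≢ v → decEq? u v ≡ false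
decEq?-≢ {u = u} {v} u≢v = trans (decEq?≡does u v) (dec-false (u ≟ v) u≢v)

decEq?-sym : ∀ {n} (u v : Fin n) → decEq? u v ≡ decEq? v u
decEq?-sym u v = begin
  decEq? u v      ≡⟨ decEq?≡does u v ⟩
  does (u ≟ v)    ≡⟨ does-⇔ (mk⇔ sym sym) (u ≟ v) (v ≟ u) ⟩
  does (v ≟ u)    ≡⟨ sym (decEq?≡does v u) ⟩
  decEq? v u      ∎
  where open ≡-Reasoning

∑-𝟙-decEq? : ∀ {n} (x : Fin n) (g : Fin n → Bool) → ∑[ y < n ] 𝟙 (decEq? x y ∧ g y) ≡ 𝟙 (g x)
∑-𝟙-decEq? x g = begin
  ∑[ y < _ ] 𝟙 (decEq? x y ∧ g y)
    ≡⟨ ∑-concentrated _ x (λ y y≢x → cong (λ d → 𝟙 (d ∧ g y)) (decEq?-≢ (y≢x ∘ sym))) ⟩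
  𝟙 (decEq? x x ∧ g x)
    ≡⟨ cong (λ d → 𝟙 (d ∧ g x)) (decEq?-refl x) ⟩
  𝟙 (g x) ∎
  where open ≡-Reasoning

∣p∣≡∑𝟙 : ∀ {n} (p : Subset n) → ∣ p ∣ ≡ ∑[ x < n ] 𝟙 (lookup p x)
∣p∣≡∑𝟙 []            = refl
∣p∣≡∑𝟙 (inside  ∷ p) = cong suc (∣p∣≡∑𝟙 p)
∣p∣≡∑𝟙 (outside ∷ p) = ∣p∣≡∑𝟙 p

T-lookup⇒∈ : ∀ {n} {p : Subset n} {x} → T (lookup p x) → x ∈ p
T-lookup⇒∈ {p = p} {x} t = lookup⇒[]= x p (Equivalence.to T-≡ t)

∈⇒T-lookup : ∀ {n} {p : Subset n} {x} → x ∈ p → T (lookup p x)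
∈⇒T-lookup x∈p = Equivalence.from T-≡ ([]=⇒lookup x∈p)

p⊆q⇒∣q∣≤∣p∣⇒p≡q : ∀ {n} {p q : Subset n} → p ⊆ q → ∣ q ∣ ≤ ∣ p ∣ → p ≡ q
p⊆q⇒∣q∣≤∣p∣⇒p≡q {p = []}          {[]}          _   _         = refl
p⊆q⇒∣q∣≤∣p∣⇒p≡q {p = outside ∷ p} {outside ∷ q} p⊆q q≤p       =
  cong (outside ∷_) (p⊆q⇒∣q∣≤∣p∣⇒p≡q (drop-∷-⊆ p⊆q) q≤p)
p⊆q⇒∣q∣≤∣p∣⇒p≡q {p = outside ∷ p} {inside  ∷ q} p⊆q q<p       =
  contradiction (≤-trans q<p (p⊆q⇒∣p∣≤∣q∣ (drop-∷-⊆ p⊆q))) (n≮n ∣ q ∣)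
p⊆q⇒∣q∣≤∣p∣⇒p≡q {p = inside  ∷ p} {outside ∷ q} p⊆q _         = contradiction (p⊆q here) λ ()
p⊆q⇒∣q∣≤∣p∣⇒p≡q {p = inside  ∷ p} {inside  ∷ q} p⊆q (s≤s q≤p) =
  cong (inside ∷_) (p⊆q⇒∣q∣≤∣p∣⇒p≡q (drop-∷-⊆ p⊆q) q≤p)

x∈p⇒⁅x⁆⊆p : ∀ {n} {p : Subset n} {x} → x ∈ p → ⁅ x ⁆ ⊆ p
x∈p⇒⁅x⁆⊆p x∈p y∈⁅x⁆ = subst (_∈ _) (sym (x∈⁅y⁆⇒x≡y _ y∈⁅x⁆)) x∈p

x,y∈p⇒⁅x⁆∪⁅y⁆⊆p : ∀ {n} {p : Subset n} {x y} → x ∈ p → y ∈ p → ⁅ x ⁆ ∪ ⁅ y ⁆ ⊆ p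
x,y∈p⇒⁅x⁆∪⁅y⁆⊆p x∈p y∈p z∈⁅x⁆∪⁅y⁆ =
  [ x∈p⇒⁅x⁆⊆p x∈p , x∈p⇒⁅x⁆⊆p y∈p ] (x∈p∪q⁻ _ _ z∈⁅x⁆∪⁅y⁆)

x≢y⇒2≤∣⁅x⁆∪⁅y⁆∣ : ∀ {n} {x y : Fin n} → x ≢ y → 2 ≤ ∣ ⁅ x ⁆ ∪ ⁅ y ⁆ ∣
x≢y⇒2≤∣⁅x⁆∪⁅y⁆∣ {x = x} {y} x≢y = subst (_< ∣ ⁅ x ⁆ ∪ ⁅ y ⁆ ∣) (∣⁅x⁆∣≡1 x)
  (p⊂q⇒∣p∣<∣q∣ (p⊆p∪q _ , y , x∈p∪q⁺ (inj₂ (x∈⁅x⁆ y)) , x≢y⇒x∉⁅y⁆ (x≢y ∘ sym)))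

distinctPair : ∀ {n} → Subset n → Fin n → Fin n → Bool
distinctPair p x y = not (decEq? x y) ∧ (lookup p x ∧ lookup p y)

distinctPairs : ∀ {n} → Subset n → ℕ
distinctPairs {n} p = ∑[ x < n ] ∑[ y < n ] 𝟙 (distinctPair p x y)

distinctPairs+∣p∣≡∣p∣*∣p∣ : ∀ {n} (p : Subset n) → distinctPairs p + ∣ p ∣ ≡ ∣ p ∣ * ∣ p ∣
distinctPairs+∣p∣≡∣p∣*∣p∣ {n} p = sym (begin
  ∣ p ∣ * ∣ p ∣
    ≡⟨ cong₂ _*_ (∣p∣≡∑𝟙 p) (∣p∣≡∑𝟙 p) ⟩
  (∑[ x < n ] 𝟙 (lookup p x)) * (∑[ y < n ] 𝟙 (lookup p y))
    ≡⟨ *-distribʳ-sum _ (𝟙 ∘ lookup p) ⟩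
  ∑[ x < n ] (𝟙 (lookup p x) * ∑[ y < n ] 𝟙 (lookup p y))
    ≡⟨ sum-cong-≗ (λ x → *-distribˡ-sum (𝟙 (lookup p x)) (𝟙 ∘ lookup p)) ⟩
  ∑[ x < n ] ∑[ y < n ] (𝟙 (lookup p x) * 𝟙 (lookup p y))
    ≡⟨ sum-cong-≗ (λ x → sum-cong-≗ (λ y → trans (sym (𝟙-∧ (lookup p x) (lookup p y)))
                                                  (𝟙-split (decEq? x y) (both x y)))) ⟩
  ∑[ x < n ] ∑[ y < n ] (𝟙 (distinctPair p x y) + 𝟙 (diagonal x y))
    ≡⟨ sum-cong-≗ (λ x → ∑-distrib-+ (𝟙 ∘ distinctPair p x) (𝟙 ∘ diagonal x)) ⟩
  ∑[ x < n ] (∑[ y < n ] 𝟙 (distinctPair p x y) + ∑[ y < n ] 𝟙 (diagonal x y))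
    ≡⟨ ∑-distrib-+ (λ x → ∑[ y < n ] 𝟙 (distinctPair p x y)) (λ x → ∑[ y < n ] 𝟙 (diagonal x y)) ⟩
  distinctPairs p + ∑[ x < n ] ∑[ y < n ] 𝟙 (diagonal x y)
    ≡⟨ cong (distinctPairs p +_) (sum-cong-≗ diagonal-row) ⟩
  distinctPairs p + ∑[ x < n ] 𝟙 (lookup p x)
    ≡⟨ cong (distinctPairs p +_) (sym (∣p∣≡∑𝟙 p)) ⟩
  distinctPairs p + ∣ p ∣ ∎)
  where
    open ≡-Reasoning
    both diagonal : Fin n → Fin n → Bool
    both x y = lookup p x ∧ lookup p y
    diagonal x y = decEq? x y ∧ both x y
    diagonal-row : ∀ x → ∑[ y < n ] 𝟙 (diagonal x y) ≡ 𝟙 (lookup p x)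
    diagonal-row x = trans (∑-𝟙-decEq? x (both x)) (cong 𝟙 (∧-idem (lookup p x)))

𝟙[m≡1]*m≡𝟙[m≡1] : ∀ m → 𝟙 (m ≡ᵇ 1) * m ≡ 𝟙 (m ≡ᵇ 1)
𝟙[m≡1]*m≡𝟙[m≡1] 0               = refl
𝟙[m≡1]*m≡𝟙[m≡1] 1               = refl
𝟙[m≡1]*m≡𝟙[m≡1] (suc (suc m))   = refl

d+m≡m*m⇒𝟙[m≡2]*d≡𝟙[m≡2]*2 : ∀ d m → d + m ≡ m * m → 𝟙 (m ≡ᵇ 2) * d ≡ 𝟙 (m ≡ᵇ 2) * 2
d+m≡m*m⇒𝟙[m≡2]*d≡𝟙[m≡2]*2 d 0                   _ = refl
d+m≡m*m⇒𝟙[m≡2]*d≡𝟙[m≡2]*2 d 1                   _ = refl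
d+m≡m*m⇒𝟙[m≡2]*d≡𝟙[m≡2]*2 d 2                   e = cong (1 *_) (+-cancelʳ-≡ 2 d 2 e)
d+m≡m*m⇒𝟙[m≡2]*d≡𝟙[m≡2]*2 d (suc (suc (suc m))) _ = refl

module InjectiveFamily {m n} (f : Fin m → Subset n) (f-injective : Injective _≡_ _≡_ f)
                       {C : Subset n} (f⊆C : ∀ v → f v ⊆ C) where

  singletons≤∣C∣ : ∑[ v < m ] 𝟙 (∣ f v ∣ ≡ᵇ 1) ≤ ∣ C ∣
  singletons≤∣C∣ = begin
    ∑[ v < m ] 𝟙 (∣ f v ∣ ≡ᵇ 1)
      ≡⟨ sum-cong-≗ (λ v → sym (𝟙[m≡1]*m≡𝟙[m≡1] ∣ f v ∣)) ⟩
    ∑[ v < m ] (𝟙 (∣ f v ∣ ≡ᵇ 1) * ∣ f v ∣)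
      ≡⟨ sum-cong-≗ (λ v → trans (cong (𝟙 (∣ f v ∣ ≡ᵇ 1) *_) (∣p∣≡∑𝟙 (f v)))
                                  (*-distribˡ-sum (𝟙 (∣ f v ∣ ≡ᵇ 1)) (𝟙 ∘ lookup (f v)))) ⟩
    ∑[ v < m ] ∑[ x < n ] (𝟙 (∣ f v ∣ ≡ᵇ 1) * 𝟙 (lookup (f v) x))
      ≡⟨ ∑-comm (λ v x → 𝟙 (∣ f v ∣ ≡ᵇ 1) * 𝟙 (lookup (f v) x)) ⟩
    ∑[ x < n ] ∑[ v < m ] (𝟙 (∣ f v ∣ ≡ᵇ 1) * 𝟙 (lookup (f v) x))
      ≡⟨ sum-cong-≗ (λ x → sum-cong-≗ (λ v → sym (𝟙-∧ (∣ f v ∣ ≡ᵇ 1) (lookup (f v) x)))) ⟩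
    ∑[ x < n ] ∑[ v < m ] 𝟙 ((∣ f v ∣ ≡ᵇ 1) ∧ lookup (f v) x)
      ≤⟨ ∑-mono-≤ (λ x → ∑-𝟙-unique≤𝟙 _ (lookup C x) (unique x) (∈C x)) ⟩
    ∑[ x < n ] 𝟙 (lookup C x)
      ≡⟨ sym (∣p∣≡∑𝟙 C) ⟩
    ∣ C ∣ ∎
    where
      open ≤-Reasoning
      singleton : ∀ {x v} → T ((∣ f v ∣ ≡ᵇ 1) ∧ lookup (f v) x) → ⁅ x ⁆ ≡ f v
      singleton {x} {v} t with T-∧⁻ {∣ f v ∣ ≡ᵇ 1} t
      ... | ∣fv∣≡1 , x∈fv = p⊆q⇒∣q∣≤∣p∣⇒p≡q (x∈p⇒⁅x⁆⊆p (T-lookup⇒∈ x∈fv))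
                              (≤-reflexive (trans (≡ᵇ⇒≡ _ 1 ∣fv∣≡1) (sym (∣⁅x⁆∣≡1 x))))
      unique : ∀ x {v w} → T ((∣ f v ∣ ≡ᵇ 1) ∧ lookup (f v) x) →
               T ((∣ f w ∣ ≡ᵇ 1) ∧ lookup (f w) x) → v ≡ w
      unique x tv tw = f-injective (trans (sym (singleton tv)) (singleton tw))
      ∈C : ∀ x {v} → T ((∣ f v ∣ ≡ᵇ 1) ∧ lookup (f v) x) → T (lookup C x)
      ∈C x {v} t = ∈⇒T-lookup (f⊆C v (T-lookup⇒∈ (proj₂ (T-∧⁻ {∣ f v ∣ ≡ᵇ 1} t))))

  pairs≤distinctPairs : ∑[ v < m ] (𝟙 (∣ f v ∣ ≡ᵇ 2) * 2) ≤ distinctPairs C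
  pairs≤distinctPairs = begin
    ∑[ v < m ] (𝟙 (∣ f v ∣ ≡ᵇ 2) * 2)
      ≡⟨ sum-cong-≗ (λ v → sym (d+m≡m*m⇒𝟙[m≡2]*d≡𝟙[m≡2]*2 _ ∣ f v ∣ (distinctPairs+∣p∣≡∣p∣*∣p∣ (f v)))) ⟩
    ∑[ v < m ] (𝟙 (∣ f v ∣ ≡ᵇ 2) * distinctPairs (f v))
      ≡⟨ sum-cong-≗ (λ v → distribute (𝟙 (∣ f v ∣ ≡ᵇ 2)) (distinctPair (f v))) ⟩
    ∑[ v < m ] ∑[ x < n ] ∑[ y < n ] (𝟙 (∣ f v ∣ ≡ᵇ 2) * 𝟙 (distinctPair (f v) x y))
      ≡⟨ ∑-comm (λ v x → ∑[ y < n ] (𝟙 (∣ f v ∣ ≡ᵇ 2) * 𝟙 (distinctPair (f v) x y))) ⟩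
    ∑[ x < n ] ∑[ v < m ] ∑[ y < n ] (𝟙 (∣ f v ∣ ≡ᵇ 2) * 𝟙 (distinctPair (f v) x y))
      ≡⟨ sum-cong-≗ (λ x → ∑-comm (λ v y → 𝟙 (∣ f v ∣ ≡ᵇ 2) * 𝟙 (distinctPair (f v) x y))) ⟩
    ∑[ x < n ] ∑[ y < n ] ∑[ v < m ] (𝟙 (∣ f v ∣ ≡ᵇ 2) * 𝟙 (distinctPair (f v) x y))
      ≡⟨ sum-cong-≗ (λ x → sum-cong-≗ (λ y → sum-cong-≗ (λ v →
           sym (𝟙-∧ (∣ f v ∣ ≡ᵇ 2) (distinctPair (f v) x y))))) ⟩
    ∑[ x < n ] ∑[ y < n ] ∑[ v < m ] 𝟙 ((∣ f v ∣ ≡ᵇ 2) ∧ distinctPair (f v) x y)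
      ≤⟨ ∑-mono-≤ (λ x → ∑-mono-≤ (λ y → ∑-𝟙-unique≤𝟙 _ (distinctPair C x y) (unique x y) (∈C x y))) ⟩
    distinctPairs C ∎
    where
      open ≤-Reasoning
      distribute : ∀ a (g : Fin n → Fin n → Bool) →
                   a * ∑[ x < n ] ∑[ y < n ] 𝟙 (g x y) ≡ ∑[ x < n ] ∑[ y < n ] (a * 𝟙 (g x y))
      distribute a g = trans (*-distribˡ-sum a (λ x → ∑[ y < n ] 𝟙 (g x y)))
                             (sum-cong-≗ (λ x → *-distribˡ-sum a (λ y → 𝟙 (g x y))))
      members : ∀ {p : Subset n} x y → T (distinctPair p x y) → x ≢ y × x ∈ p × y ∈ p
      members {p} x y t with T-∧⁻ {not (decEq? x y)} t
      ... | x≢y , xy∈p with T-∧⁻ {lookup p x} xy∈p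
      ... | x∈p , y∈p =
        (λ { refl → subst (T ∘ not) (decEq?-refl x) x≢y }) , T-lookup⇒∈ x∈p , T-lookup⇒∈ y∈p
      pair : ∀ {x y v} → T ((∣ f v ∣ ≡ᵇ 2) ∧ distinctPair (f v) x y) → ⁅ x ⁆ ∪ ⁅ y ⁆ ≡ f v
      pair {x} {y} {v} t with T-∧⁻ {∣ f v ∣ ≡ᵇ 2} t
      ... | ∣fv∣≡2 , xy with members x y xy
      ... | x≢y , x∈fv , y∈fv = p⊆q⇒∣q∣≤∣p∣⇒p≡q (x,y∈p⇒⁅x⁆∪⁅y⁆⊆p x∈fv y∈fv)
                                  (subst (_≤ ∣ ⁅ x ⁆ ∪ ⁅ y ⁆ ∣) (sym (≡ᵇ⇒≡ _ 2 ∣fv∣≡2)) (x≢y⇒2≤∣⁅x⁆∪⁅y⁆∣ x≢y))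
      unique : ∀ x y {v w} → T ((∣ f v ∣ ≡ᵇ 2) ∧ distinctPair (f v) x y) →
               T ((∣ f w ∣ ≡ᵇ 2) ∧ distinctPair (f w) x y) → v ≡ w
      unique x y tv tw = f-injective (trans (sym (pair {x} {y} tv)) (pair {x} {y} tw))
      ∈C : ∀ x y {v} → T ((∣ f v ∣ ≡ᵇ 2) ∧ distinctPair (f v) x y) → T (distinctPair C x y)
      ∈C x y {v} t with T-∧⁻ {∣ f v ∣ ≡ᵇ 2} t
      ... | _ , xy with T-∧⁻ {not (decEq? x y)} xy | members x y xy
      ... | x≢y , _ | _ , x∈fv , y∈fv =
        T-∧⁺ x≢y (T-∧⁺ (∈⇒T-lookup (f⊆C v x∈fv)) (∈⇒T-lookup (f⊆C v y∈fv)))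

Nonempty⇒1≤∣p∣ : ∀ {n} {p : Subset n} → Nonempty p → 1 ≤ ∣ p ∣
Nonempty⇒1≤∣p∣ {p = p} (x , x∈p) = subst (_≤ ∣ p ∣) (∣⁅x⁆∣≡1 x) (p⊆q⇒∣p∣≤∣q∣ (x∈p⇒⁅x⁆⊆p x∈p))

module _ {n} (G : Graph n) where

  N[]-lookup : ∀ v x → lookup N[ G , v ] x ≡ decEq? v x ∨ adj G v x
  N[]-lookup v x = lookup∘tabulate (λ y → decEq? v y ∨ adj G v y) x

  N[]-sym : ∀ v x → lookup N[ G , v ] x ≡ lookup N[ G , x ] v
  N[]-sym v x = begin
    lookup N[ G , v ] x       ≡⟨ N[]-lookup v x ⟩
    decEq? v x ∨ adj G v x    ≡⟨ cong₂ _∨_ (decEq?-sym v x) (Graph.sym G v x) ⟩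
    decEq? x v ∨ adj G x v    ≡⟨ sym (N[]-lookup x v) ⟩
    lookup N[ G , x ] v       ∎
    where open ≡-Reasoning

  ∣N[u]∣≤1+degree : ∀ u → ∣ N[ G , u ] ∣ ≤ suc (degree G u)
  ∣N[u]∣≤1+degree u = begin
    ∣ N[ G , u ] ∣
      ≡⟨ ∣p∣≡∑𝟙 N[ G , u ] ⟩
    ∑[ v < n ] 𝟙 (lookup N[ G , u ] v)
      ≡⟨ sum-cong-≗ (cong 𝟙 ∘ N[]-lookup u) ⟩
    ∑[ v < n ] 𝟙 (decEq? u v ∨ adj G u v)
      ≤⟨ ∑-mono-≤ (λ v → 𝟙-∨ (decEq? u v) (adj G u v)) ⟩
    ∑[ v < n ] (𝟙 (decEq? u v) + 𝟙 (adj G u v))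
      ≡⟨ ∑-distrib-+ (𝟙 ∘ decEq? u) (𝟙 ∘ adj G u) ⟩
    ∑[ v < n ] 𝟙 (decEq? u v) + ∑[ v < n ] 𝟙 (adj G u v)
      ≡⟨ cong₂ _+_ self neighbours ⟩
    suc (degree G u) ∎
    where
      open ≤-Reasoning
      self : ∑[ v < n ] 𝟙 (decEq? u v) ≡ 1
      self = trans (∑-concentrated (𝟙 ∘ decEq? u) u (λ v v≢u → cong 𝟙 (decEq?-≢ (v≢u ∘ sym))))
                   (cong 𝟙 (decEq?-refl u))
      neighbours : ∑[ v < n ] 𝟙 (adj G u v) ≡ degree G u
      neighbours = sym (trans (∣p∣≡∑𝟙 (N G u)) (sum-cong-≗ (cong 𝟙 ∘ lookup∘tabulate (adj G u))))

  ∑∣N[v]∩C∣≤ : ∀ {k} (C : Subset n) → (∀ u → degree G u ≤ k) →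
               ∑[ v < n ] ∣ N[ G , v ] ∩ C ∣ ≤ suc k * ∣ C ∣
  ∑∣N[v]∩C∣≤ {k} C degree≤k = begin
    ∑[ v < n ] ∣ N[ G , v ] ∩ C ∣
      ≡⟨ sum-cong-≗ (λ v → trans (∣p∣≡∑𝟙 (N[ G , v ] ∩ C)) (sum-cong-≗ (swap v))) ⟩
    ∑[ v < n ] ∑[ x < n ] (𝟙 (lookup C x) * 𝟙 (lookup N[ G , x ] v))
      ≡⟨ ∑-comm (λ v x → 𝟙 (lookup C x) * 𝟙 (lookup N[ G , x ] v)) ⟩
    ∑[ x < n ] ∑[ v < n ] (𝟙 (lookup C x) * 𝟙 (lookup N[ G , x ] v))
      ≡⟨ sum-cong-≗ (λ x → sym (trans (cong (𝟙 (lookup C x) *_) (∣p∣≡∑𝟙 N[ G , x ]))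
                                       (*-distribˡ-sum (𝟙 (lookup C x)) (𝟙 ∘ lookup N[ G , x ])))) ⟩
    ∑[ x < n ] (𝟙 (lookup C x) * ∣ N[ G , x ] ∣)
      ≤⟨ ∑-mono-≤ (λ x → *-monoʳ-≤ (𝟙 (lookup C x)) (≤-trans (∣N[u]∣≤1+degree x) (s≤s (degree≤k x)))) ⟩
    ∑[ x < n ] (𝟙 (lookup C x) * suc k)
      ≡⟨ sym (*-distribʳ-sum (suc k) (𝟙 ∘ lookup C)) ⟩
    (∑[ x < n ] 𝟙 (lookup C x)) * suc k
      ≡⟨ trans (cong (_* suc k) (sym (∣p∣≡∑𝟙 C))) (*-comm ∣ C ∣ (suc k)) ⟩
    suc k * ∣ C ∣ ∎
    where
      open ≤-Reasoning
      swap : ∀ v x → 𝟙 (lookup (N[ G , v ] ∩ C) x) ≡ 𝟙 (lookup C x) * 𝟙 (lookup N[ G , x ] v)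
      swap v x = begin-equality
        𝟙 (lookup (N[ G , v ] ∩ C) x)               ≡⟨ cong 𝟙 (lookup-zipWith _∧_ x N[ G , v ] C) ⟩
        𝟙 (lookup N[ G , v ] x ∧ lookup C x)        ≡⟨ 𝟙-∧ (lookup N[ G , v ] x) (lookup C x) ⟩
        𝟙 (lookup N[ G , v ] x) * 𝟙 (lookup C x)    ≡⟨ cong (λ b → 𝟙 b * 𝟙 (lookup C x)) (N[]-sym v x) ⟩
        𝟙 (lookup N[ G , x ] v) * 𝟙 (lookup C x)    ≡⟨ *-comm (𝟙 (lookup N[ G , x ] v)) (𝟙 (lookup C x)) ⟩
        𝟙 (lookup C x) * 𝟙 (lookup N[ G , x ] v)    ∎

  identifying⇒injective : ∀ {C} → IdentifyingCode G C → Injective _≡_ _≡_ (λ v → N[ G , v ] ∩ C)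
  identifying⇒injective (_ , separates) {v} {w} eq with v ≟ w
  ... | yes v≡w = v≡w
  ... | no  v≢w = contradiction eq (separates v w v≢w)

weight : ℕ → ℕ
weight m = 2 * m + 4 * 𝟙 (m ≡ᵇ 1) + 𝟙 (m ≡ᵇ 2) * 2

6≤weight : ∀ m → 1 ≤ m → 6 ≤ weight m
6≤weight 1                   _ = ≤-refl
6≤weight 2                   _ = ≤-refl
6≤weight (suc (suc (suc m))) _ = ≤-trans (*-monoʳ-≤ 2 (m≤m+n 3 m)) (≤-trans (m≤m+n _ _) (m≤m+n _ _))

∑-weight : ∀ {n} (s : Fin n → ℕ) →
           ∑[ v < n ] weight (s v) ≡
           2 * sum s + 4 * ∑[ v < n ] 𝟙 (s v ≡ᵇ 1) + ∑[ v < n ] (𝟙 (s v ≡ᵇ 2) * 2)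
∑-weight s = begin
  ∑[ v < _ ] weight (s v)
    ≡⟨ ∑-distrib-+ (λ v → 2 * s v + 4 * 𝟙 (s v ≡ᵇ 1)) (λ v → 𝟙 (s v ≡ᵇ 2) * 2) ⟩
  ∑[ v < _ ] (2 * s v + 4 * 𝟙 (s v ≡ᵇ 1)) + ∑[ v < _ ] (𝟙 (s v ≡ᵇ 2) * 2)
    ≡⟨ cong (_+ ∑[ v < _ ] (𝟙 (s v ≡ᵇ 2) * 2)) (∑-distrib-+ (λ v → 2 * s v) (λ v → 4 * 𝟙 (s v ≡ᵇ 1))) ⟩
  ∑[ v < _ ] (2 * s v) + ∑[ v < _ ] (4 * 𝟙 (s v ≡ᵇ 1)) + ∑[ v < _ ] (𝟙 (s v ≡ᵇ 2) * 2)
    ≡⟨ cong (_+ ∑[ v < _ ] (𝟙 (s v ≡ᵇ 2) * 2))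
            (sym (cong₂ _+_ (*-distribˡ-sum 2 s) (*-distribˡ-sum 4 (λ v → 𝟙 (s v ≡ᵇ 1))))) ⟩
  2 * sum s + 4 * ∑[ v < _ ] 𝟙 (s v ≡ᵇ 1) + ∑[ v < _ ] (𝟙 (s v ≡ᵇ 2) * 2) ∎
  where open ≡-Reasoning

collect : ∀ k c d → 2 * (suc k * c) + 4 * c + d ≡ (d + c) + (2 * k + 5) * c
collect = solve 3 (λ k c d → con 2 :* ((con 1 :+ k) :* c) :+ con 4 :* c :+ d
                             := (d :+ c) :+ (con 2 :* k :+ con 5) :* c) refl
  where open +-*-Solver

proposition1p3 : ∀ (n : ℕ) (G : Graph n) (k : ℕ) (C : Subset n) →
    TwinFree G → MaxDegree G k → IdentifyingCode G C →
    suc ∣ C ∣ ≤ k →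
    6 * n ≤ ∣ C ∣ * ∣ C ∣ + (2 * k + 5) * ∣ C ∣
proposition1p3 n G k C _ (degree≤k , _) identifying@(dominating , _) _ = begin
  6 * n
    ≡⟨ trans (*-comm 6 n) (sym (∑-const n 6)) ⟩
  ∑[ v < n ] 6
    ≤⟨ ∑-mono-≤ (λ v → 6≤weight ∣ code v ∣ (Nonempty⇒1≤∣p∣ (dominating v))) ⟩
  ∑[ v < n ] weight ∣ code v ∣
    ≡⟨ ∑-weight (λ v → ∣ code v ∣) ⟩
  2 * ∑[ v < n ] ∣ code v ∣ + 4 * ∑[ v < n ] 𝟙 (∣ code v ∣ ≡ᵇ 1) + ∑[ v < n ] (𝟙 (∣ code v ∣ ≡ᵇ 2) * 2)
    ≤⟨ +-mono-≤ (+-mono-≤ (*-monoʳ-≤ 2 (∑∣N[v]∩C∣≤ G C degree≤k)) (*-monoʳ-≤ 4 singletons≤∣C∣))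
                pairs≤distinctPairs ⟩
  2 * (suc k * ∣ C ∣) + 4 * ∣ C ∣ + distinctPairs C
    ≡⟨ collect k ∣ C ∣ (distinctPairs C) ⟩
  (distinctPairs C + ∣ C ∣) + (2 * k + 5) * ∣ C ∣
    ≡⟨ cong (_+ (2 * k + 5) * ∣ C ∣) (distinctPairs+∣p∣≡∣p∣*∣p∣ C) ⟩
  ∣ C ∣ * ∣ C ∣ + (2 * k + 5) * ∣ C ∣ ∎
  where
    open ≤-Reasoning
    code : Fin n → Subset n
    code v = N[ G , v ] ∩ C
    open InjectiveFamily code (identifying⇒injective G identifying) (λ v → p∩q⊆q N[ G , v ] C)
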